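{- Let $U$ be a finite set and let $a_1,a_2,a_3\ge0$. Then $f(S)=a_1|S|+a_2|S|^2+a_3|S|^3$ is weakly submodular.
   Context: A normalized ($f(\emptyset)=0$), non-negative set function $f$ on a finite universe $U$ is called weakly submodular if for all $S,T\subseteq U$: $|T|f(S)+|S|f(T)\ge |S\cap T|\,f(S\cup T)+|S\cup T|\,f(S\cap T)$.
   Formalization: The coefficients $a_1,a_2,a_3$ are non-negative rationals, so the set function f takes rational values. -}

module Defs where

open import Data.Nat using (ℕ)
open import Data.Integer using (+_)
open import Data.Rational using (ℚ; 0ℚ; _+_; _*_; _≤_; _/_)
open import Data.Fin.Subset using (Subset; ⊥; _∩_; _∪_; ∣_∣)
open import Data.Product using (_×_)
open import Relation.Binary.PropositionalEquality using (_≡_)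

ℕ→ℚ : ℕ → ℚ
ℕ→ℚ k = (+ k) / 1

WeaklySubmodular : {n : ℕ} → (Subset n → ℚ) → Set
WeaklySubmodular {n} f =
  (f ⊥ ≡ 0ℚ)
  × ((S : Subset n) → 0ℚ ≤ f S)
  × ((S T : Subset n) →
       (ℕ→ℚ ∣ S ∩ T ∣ * f (S ∪ T)) + (ℕ→ℚ ∣ S ∪ T ∣ * f (S ∩ T))
         ≤ (ℕ→ℚ ∣ T ∣ * f S) + (ℕ→ℚ ∣ S ∣ * f T))

cubicCard : {n : ℕ} → ℚ → ℚ → ℚ → Subset n → ℚ
cubicCard a₁ a₂ a₃ S =
  let s = ℕ→ℚ ∣ S ∣ in
  (a₁ * s) + (a₂ * (s * s)) + (a₃ * (s * (s * s)))

{-# OPTIONS --safe #-}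
module Submission where

-- A cardinality-based function S ↦ g |S| is weakly submodular as soon as g
-- satisfies the defining inequality at |S ∩ T| = i, |S ─ T| = a, |T ─ S| = b,
-- so that |S| = i + a, |T| = i + b and |S ∪ T| = i + a + b.  For the cubic
-- g(s) = a₁ s + a₂ s² + a₃ s³ the slack of that inequality is the polynomial
-- a b (2 a₁ + a₂ (2 i + a + b) + a₃ (a² + b²)), nonnegative for nonnegative data.

open import Defs
open import Data.Nat as ℕ using (ℕ; suc)
open import Data.Nat.Properties using (+-suc)
open import Data.Integer as ℤ using (+_)
import Data.Integer.Properties as ℤ
import Data.Nat.Coprimality as Coprime
open import Data.Rational using (ℚ; 0ℚ; _≤_; _+_; _*_; _/_; mkℚ; nonNegative)
open import Data.Rational.Properties
  using (normalize-coprime; normalize-nonNeg; nonNegative⁻¹; nonNeg*nonNeg⇒nonNeg;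
         +-mono-≤; +-monoʳ-≤; +-identityʳ; module ≤-Reasoning)
open import Data.Rational.Solver using (module +-*-Solver)
open import Data.Fin.Subset using (Subset; _∩_; _∪_; _─_; ∣_∣; inside; outside)
open import Data.Fin.Subset.Properties using (∣⊥∣≡0; ∩-comm)
open import Data.Vec using ([]; _∷_)
open import Data.Product using (_,_)
open import Function using (_∘_)
open import Relation.Binary.PropositionalEquality

private
  variable
    n : ℕ

∣p∣≡∣p∩q∣+∣p─q∣ : (p q : Subset n) → ∣ p ∣ ≡ ∣ p ∩ q ∣ ℕ.+ ∣ p ─ q ∣
∣p∣≡∣p∩q∣+∣p─q∣ []            []            = refl
∣p∣≡∣p∩q∣+∣p─q∣ (inside  ∷ p) (inside  ∷ q) = cong suc (∣p∣≡∣p∩q∣+∣p─q∣ p q)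
∣p∣≡∣p∩q∣+∣p─q∣ (inside  ∷ p) (outside ∷ q) =
  trans (cong suc (∣p∣≡∣p∩q∣+∣p─q∣ p q)) (sym (+-suc _ _))
∣p∣≡∣p∩q∣+∣p─q∣ (outside ∷ p) (inside  ∷ q) = ∣p∣≡∣p∩q∣+∣p─q∣ p q
∣p∣≡∣p∩q∣+∣p─q∣ (outside ∷ p) (outside ∷ q) = ∣p∣≡∣p∩q∣+∣p─q∣ p q

∣q∣≡∣p∩q∣+∣q─p∣ : (p q : Subset n) → ∣ q ∣ ≡ ∣ p ∩ q ∣ ℕ.+ ∣ q ─ p ∣
∣q∣≡∣p∩q∣+∣q─p∣ p q rewrite ∩-comm p q = ∣p∣≡∣p∩q∣+∣p─q∣ q p

∣p∪q∣≡∣p∩q∣+∣p─q∣+∣q─p∣ : (p q : Subset n) → ∣ p ∪ q ∣ ≡ ∣ p ∩ q ∣ ℕ.+ ∣ p ─ q ∣ ℕ.+ ∣ q ─ p ∣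
∣p∪q∣≡∣p∩q∣+∣p─q∣+∣q─p∣ []            []            = refl
∣p∪q∣≡∣p∩q∣+∣p─q∣+∣q─p∣ (inside  ∷ p) (inside  ∷ q) = cong suc (∣p∪q∣≡∣p∩q∣+∣p─q∣+∣q─p∣ p q)
∣p∪q∣≡∣p∩q∣+∣p─q∣+∣q─p∣ (inside  ∷ p) (outside ∷ q) =
  trans (cong suc (∣p∪q∣≡∣p∩q∣+∣p─q∣+∣q─p∣ p q)) (cong (ℕ._+ ∣ q ─ p ∣) (sym (+-suc _ _)))
∣p∪q∣≡∣p∩q∣+∣p─q∣+∣q─p∣ (outside ∷ p) (inside  ∷ q) =
  trans (cong suc (∣p∪q∣≡∣p∩q∣+∣p─q∣+∣q─p∣ p q)) (sym (+-suc _ _))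
∣p∪q∣≡∣p∩q∣+∣p─q∣+∣q─p∣ (outside ∷ p) (outside ∷ q) = ∣p∪q∣≡∣p∩q∣+∣p─q∣+∣q─p∣ p q

ℕ→ℚ≡mkℚ : ∀ k → ℕ→ℚ k ≡ mkℚ (+ k) 0 (Coprime.sym (Coprime.1-coprimeTo k))
ℕ→ℚ≡mkℚ k = normalize-coprime (Coprime.sym (Coprime.1-coprimeTo k))

ℕ→ℚ-homo-+ : ∀ m n → ℕ→ℚ (m ℕ.+ n) ≡ ℕ→ℚ m + ℕ→ℚ n
-- On the mkℚ forms of ℕ→ℚ m and ℕ→ℚ n, ℚ addition unfolds definitionally to the middle fraction.
ℕ→ℚ-homo-+ m n = begin
  + (m ℕ.+ n) / 1                    ≡⟨ cong (_/ 1) (sym (cong₂ ℤ._+_ (ℤ.*-identityʳ (+ m)) (ℤ.*-identityʳ (+ n)))) ⟩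
  (+ m ℤ.* + 1 ℤ.+ + n ℤ.* + 1) / 1  ≡⟨ cong₂ _+_ (ℕ→ℚ≡mkℚ m) (ℕ→ℚ≡mkℚ n) ⟨
  ℕ→ℚ m + ℕ→ℚ n                      ∎
  where open ≡-Reasoning

ℕ→ℚ-nonNeg : ∀ k → 0ℚ ≤ ℕ→ℚ k
ℕ→ℚ-nonNeg k = nonNegative⁻¹ (ℕ→ℚ k) {{normalize-nonNeg k 1}}

*-nonNeg : ∀ {p q} → 0ℚ ≤ p → 0ℚ ≤ q → 0ℚ ≤ p * q
*-nonNeg {p} {q} 0≤p 0≤q =
  nonNegative⁻¹ (p * q) {{nonNeg*nonNeg⇒nonNeg p {{nonNegative 0≤p}} q {{nonNegative 0≤q}}}}

p≤p+q : ∀ {p q} → 0ℚ ≤ q → p ≤ p + q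
p≤p+q {p} {q} 0≤q = subst (_≤ p + q) (+-identityʳ p) (+-monoʳ-≤ p 0≤q)

WeaklySubmodularProfile : (ℚ → ℚ) → Set
WeaklySubmodularProfile g = ∀ {i a b} → 0ℚ ≤ i → 0ℚ ≤ a → 0ℚ ≤ b →
  i * g (i + a + b) + (i + a + b) * g i ≤ (i + b) * g (i + a) + (i + a) * g (i + b)

cardinalityBased-weaklySubmodular : (g : ℚ → ℚ) → g 0ℚ ≡ 0ℚ → (∀ k → 0ℚ ≤ g (ℕ→ℚ k)) →
  WeaklySubmodularProfile g → WeaklySubmodular {n} (g ∘ ℕ→ℚ ∘ ∣_∣)
cardinalityBased-weaklySubmodular {n} g g0≡0 g-nonNeg g-profile =
  trans (cong (g ∘ ℕ→ℚ) (∣⊥∣≡0 n)) g0≡0 , g-nonNeg ∘ ∣_∣ , inequality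
  where
  profileAtℕ : ∀ i a b → let g′ = g ∘ ℕ→ℚ in
    ℕ→ℚ i * g′ (i ℕ.+ a ℕ.+ b) + ℕ→ℚ (i ℕ.+ a ℕ.+ b) * g′ i
      ≤ ℕ→ℚ (i ℕ.+ b) * g′ (i ℕ.+ a) + ℕ→ℚ (i ℕ.+ a) * g′ (i ℕ.+ b)
  profileAtℕ i a b rewrite ℕ→ℚ-homo-+ (i ℕ.+ a) b | ℕ→ℚ-homo-+ i a | ℕ→ℚ-homo-+ i b =
    g-profile (ℕ→ℚ-nonNeg i) (ℕ→ℚ-nonNeg a) (ℕ→ℚ-nonNeg b)

  inequality : ∀ S T → let f = g ∘ ℕ→ℚ ∘ ∣_∣ in
    ℕ→ℚ ∣ S ∩ T ∣ * f (S ∪ T) + ℕ→ℚ ∣ S ∪ T ∣ * f (S ∩ T) ≤ ℕ→ℚ ∣ T ∣ * f S + ℕ→ℚ ∣ S ∣ * f T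
  inequality S T
    rewrite ∣p∪q∣≡∣p∩q∣+∣p─q∣+∣q─p∣ S T | ∣p∣≡∣p∩q∣+∣p─q∣ S T | ∣q∣≡∣p∩q∣+∣q─p∣ S T =
    profileAtℕ (∣ S ∩ T ∣) (∣ S ─ T ∣) (∣ T ─ S ∣)

cubic : ℚ → ℚ → ℚ → ℚ → ℚ
cubic a₁ a₂ a₃ s = (a₁ * s) + (a₂ * (s * s)) + (a₃ * (s * (s * s)))

module _ where
  open +-*-Solver

  cubic-zero : ∀ a₁ a₂ a₃ → cubic a₁ a₂ a₃ 0ℚ ≡ 0ℚ
  cubic-zero = solve 3 (λ a₁ a₂ a₃ →
    a₁ :* con 0ℚ :+ a₂ :* (con 0ℚ :* con 0ℚ) :+ a₃ :* (con 0ℚ :* (con 0ℚ :* con 0ℚ)) := con 0ℚ) refl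

  cubic-profile-slack : ∀ a₁ a₂ a₃ i a b → let g = cubic a₁ a₂ a₃ in
    (i + b) * g (i + a) + (i + a) * g (i + b)
      ≡ (i * g (i + a + b) + (i + a + b) * g i)
        + (a * b) * ((a₁ + a₁) + a₂ * (i + i + a + b) + a₃ * (a * a + b * b))
  cubic-profile-slack = solve 6 (λ a₁ a₂ a₃ i a b →
    let g = λ s → a₁ :* s :+ a₂ :* (s :* s) :+ a₃ :* (s :* (s :* s)) in
    (i :+ b) :* g (i :+ a) :+ (i :+ a) :* g (i :+ b)
      := (i :* g (i :+ a :+ b) :+ (i :+ a :+ b) :* g i)
         :+ (a :* b) :* ((a₁ :+ a₁) :+ a₂ :* (i :+ i :+ a :+ b) :+ a₃ :* (a :* a :+ b :* b))) refl

module _ {a₁ a₂ a₃ : ℚ} (0≤a₁ : 0ℚ ≤ a₁) (0≤a₂ : 0ℚ ≤ a₂) (0≤a₃ : 0ℚ ≤ a₃) where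

  cubic-nonNeg : ∀ {s} → 0ℚ ≤ s → 0ℚ ≤ cubic a₁ a₂ a₃ s
  cubic-nonNeg {s} 0≤s =
    +-mono-≤ (+-mono-≤ (*-nonNeg 0≤a₁ 0≤s) (*-nonNeg 0≤a₂ s²-nonNeg)) (*-nonNeg 0≤a₃ (*-nonNeg 0≤s s²-nonNeg))
    where
    s²-nonNeg : 0ℚ ≤ s * s
    s²-nonNeg = *-nonNeg 0≤s 0≤s

  cubic-weaklySubmodularProfile : WeaklySubmodularProfile (cubic a₁ a₂ a₃)
  cubic-weaklySubmodularProfile {i} {a} {b} 0≤i 0≤a 0≤b =
    begin
      i * g (i + a + b) + (i + a + b) * g i
        ≤⟨ p≤p+q (*-nonNeg (*-nonNeg 0≤a 0≤b) 0≤coefficient) ⟩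
      (i * g (i + a + b) + (i + a + b) * g i) + (a * b) * coefficient
        ≡⟨ cubic-profile-slack a₁ a₂ a₃ i a b ⟨
      (i + b) * g (i + a) + (i + a) * g (i + b)
        ∎
    where
    open ≤-Reasoning
    g : ℚ → ℚ
    g = cubic a₁ a₂ a₃

    coefficient : ℚ
    coefficient = (a₁ + a₁) + a₂ * (i + i + a + b) + a₃ * (a * a + b * b)
    0≤coefficient : 0ℚ ≤ coefficient
    0≤coefficient =
      +-mono-≤ (+-mono-≤ (+-mono-≤ 0≤a₁ 0≤a₁) (*-nonNeg 0≤a₂ (+-mono-≤ (+-mono-≤ (+-mono-≤ 0≤i 0≤i) 0≤a) 0≤b)))
               (*-nonNeg 0≤a₃ (+-mono-≤ (*-nonNeg 0≤a 0≤a) (*-nonNeg 0≤b 0≤b)))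

corollary3 : (n : ℕ) (a₁ a₂ a₃ : ℚ) → 0ℚ ≤ a₁ → 0ℚ ≤ a₂ → 0ℚ ≤ a₃ →
    WeaklySubmodular {n} (cubicCard a₁ a₂ a₃)
corollary3 n a₁ a₂ a₃ 0≤a₁ 0≤a₂ 0≤a₃ =
  cardinalityBased-weaklySubmodular (cubic a₁ a₂ a₃) (cubic-zero a₁ a₂ a₃)
    (cubic-nonNeg 0≤a₁ 0≤a₂ 0≤a₃ ∘ ℕ→ℚ-nonNeg) (cubic-weaklySubmodularProfile 0≤a₁ 0≤a₂ 0≤a₃)
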